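{- Let $P$ be the Petersen graph, let $k \geq 1$, and let $\mathcal M = \{N_1,\dots,N_k\}$ be a collection (multiset) of $k$ perfect matchings of $P$. Let $P^{\mathcal M}$ be the multigraph obtained from $P$ by adding, for each $j \in \{1,\dots,k\}$, a new parallel copy of every edge of $N_j$. If $M_1',\dots,M_{k+1}'$ are $k+1$ pairwise (edge-)disjoint perfect matchings of $P^{\mathcal M}$, then $\mathcal M$ is a subcollection of the collection $\{t(M_1'),\dots,t(M_{k+1}')\}$, i.e. every perfect matching of $P$ occurs in $\mathcal M$ at most as many times as it occurs among $t(M_1'),\dots,t(M_{k+1}')$.
   Context: Graphs may have parallel edges but no loops. A collection is a multiset (repetitions allowed); a subcollection $\mathcal C' \subseteq \mathcal C$ means each element occurs in $\mathcal C'$ at most as many times as in $\mathcal C$. For a perfect matching $N$ of $P^{\mathcal M}$, its type $t(N)$ is the perfect matching of $P$ obtained by replacing each edge of $N$ by the edge of $P$ it is parallel to (or equal to). -}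

module Defs where

open import Data.Nat using (ℕ; zero; suc; _+_; _≤_)
open import Data.Bool using (Bool; true; false; if_then_else_; _∨_)
open import Data.Fin using (Fin; zero; suc; #_)
open import Data.Fin.Properties renaming (_≟_ to _≟F_)
open import Data.Product using (_×_; _,_; proj₁; proj₂)
open import Data.Vec using (Vec; []; _∷_; lookup; tabulate)
open import Data.Vec.Properties using (≡-dec)
open import Data.Bool.Properties renaming (_≟_ to _≟B_)
open import Relation.Nullary using (¬_)
open import Relation.Nullary.Decidable using (⌊_⌋)
open import Relation.Binary.PropositionalEquality using (_≡_)

countF : ∀ {n} → (Fin n → Bool) → ℕ
countF {zero} p = 0
countF {suc n} p = (if p zero then 1 else 0) + countF (λ i → p (suc i))

-- Petersen graph: vertices Fin 10 (outer cycle 0..4, inner pentagram 5..9),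
-- edges Fin 15, each given by its two endpoints.
V : Set
V = Fin 10

E : Set
E = Fin 15

endpoints : Vec (V × V) 15
endpoints =
  (# 0 , # 1) ∷ (# 1 , # 2) ∷ (# 2 , # 3) ∷ (# 3 , # 4) ∷ (# 4 , # 0) ∷
  (# 0 , # 5) ∷ (# 1 , # 6) ∷ (# 2 , # 7) ∷ (# 3 , # 8) ∷ (# 4 , # 9) ∷
  (# 5 , # 7) ∷ (# 7 , # 9) ∷ (# 9 , # 6) ∷ (# 6 , # 8) ∷ (# 8 , # 5) ∷ []

incident : V → E → Bool
incident v e = ⌊ v ≟F proj₁ (lookup endpoints e) ⌋ ∨ ⌊ v ≟F proj₂ (lookup endpoints e) ⌋

EdgeSet : Set
EdgeSet = Vec Bool 15

_∈E_ : E → EdgeSet → Bool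
e ∈E S = lookup S e

_≟S_ : EdgeSet → EdgeSet → Bool
S ≟S T = ⌊ ≡-dec _≟B_ S T ⌋

IsPerfectMatchingP : EdgeSet → Set
IsPerfectMatchingP S = ∀ (v : V) → countF (λ e → incident v e Data.Bool.∧ (e ∈E S)) ≡ 1

-- The multigraph P^M for a collection N : Fin k → EdgeSet.
-- Its edges are pairs (e , c) with e : E and c : Fin (suc k), where
-- copy c = zero is the original edge e of P and copy c = suc j is the new
-- parallel copy of e added for N_j, which exists iff e ∈ N j.
ValidEdge : ∀ {k} → (Fin k → EdgeSet) → E → Fin (suc k) → Set
ValidEdge N e zero = Data.Unit.⊤ where import Data.Unit
ValidEdge N e (suc j) = e ∈E N j ≡ true

EdgeSetM : ℕ → Set
EdgeSetM k = E → Fin (suc k) → Bool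

sumF : ∀ {n} → (Fin n → ℕ) → ℕ
sumF {zero} f = 0
sumF {suc n} f = f zero + sumF (λ i → f (suc i))

degM : ∀ {k} → EdgeSetM k → V → ℕ
degM M v = sumF (λ e → if incident v e then countF (M e) else 0)

IsPerfectMatchingM : ∀ {k} → (Fin k → EdgeSet) → EdgeSetM k → Set
IsPerfectMatchingM N M =
  (∀ e c → M e c ≡ true → ValidEdge N e c) ×
  (∀ (v : V) → degM M v ≡ 1)

Disjoint : ∀ {k} → EdgeSetM k → EdgeSetM k → Set
Disjoint M M' = ∀ e c → M e c ≡ true → M' e c ≡ false

type : ∀ {k} → EdgeSetM k → EdgeSet
type M = tabulate (λ e → Data.Bool.not (countF (M e) Data.Nat.≡ᵇ 0))

mult : ∀ {n} → (Fin n → EdgeSet) → EdgeSet → ℕ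
mult C m = countF (λ i → C i ≟S m)

module Submission where

-- The Petersen graph P has exactly six perfect matchings, and
-- any two distinct ones share an edge lying in no other perfect matching.
-- Let x_p, y_p be the multiplicities of the p-th perfect matching in N and
-- among the types t(M'_i).  All types are perfect matchings of P, so
-- Σ y = k + 1 = 1 + Σ x.  An edge e of P has 1 + #{j | e ∈ N_j} copies in
-- P^M and the M'_i are disjoint, so at most that many types contain e; for
-- the edge shared by the p-th and q-th matchings this reads
-- y_p + y_q ≤ 1 + x_p + x_q  (p ≠ q).  An arithmetic lemma shows that such
-- pairwise bounds on at least three numbers, with Σ y = 1 + Σ x, force
-- x_m ≤ y_m for every m.

open import Defs
open import Data.Bool using (Bool; true; false; if_then_else_; not; _∧_; _∨_; T)
open import Data.Bool.Properties using (T-∧) renaming (_≟_ to _≟B_)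
open import Data.Empty using (⊥-elim)
open import Data.Fin using (Fin; zero; suc; #_; punchIn)
open import Data.Fin.Properties using (any?; all?; punchIn-injective) renaming (_≟_ to _≟F_; suc-injective to fsuc-injective)
open import Data.Nat using (ℕ; zero; suc; pred; _+_; _≤_; _<_; _≡ᵇ_; z≤n; s≤s; _≤?_)
open import Data.Nat.Properties using (+-0-commutativeMonoid; +-mono-≤; +-monoʳ-≤; +-monoˡ-≤; +-assoc; +-suc; +-identityʳ; +-cancelˡ-≤; +-cancelʳ-≤; ≤-trans; ≤-reflexive; ≰⇒>; module ≤-Reasoning)
open import Data.Product using (∃; _,_; proj₁; proj₂)
open import Data.Unit using (tt)
open import Data.Vec using (Vec; []; _∷_)
open import Data.Vec.Functional using (removeAt)
open import Data.Vec.Properties using (≡-dec; lookup∘tabulate)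
open import Function using (_∘_; Equivalence)
open import Relation.Binary.PropositionalEquality using (_≡_; _≢_; _≗_; refl; sym; trans; cong; cong₂; module ≡-Reasoning)
open import Relation.Nullary using (Dec; yes; no)
open import Relation.Nullary.Decidable using (⌊_⌋; ⌊⌋-map′; toWitness; ¬?; _→-dec_)

open import Algebra.Properties.CommutativeMonoid.Sum +-0-commutativeMonoid
  using (sum; sum-cong-≗; ∑-comm; sum-remove)

ind : Bool → ℕ
ind b = if b then 1 else 0

nonzero : ℕ → Bool
nonzero n = not (n ≡ᵇ 0)

countF-as-sumF : ∀ {n} (p : Fin n → Bool) → countF p ≡ sumF (ind ∘ p)
countF-as-sumF {zero} p = refl
countF-as-sumF {suc n} p = cong (ind (p zero) +_) (countF-as-sumF (p ∘ suc))

sumF-as-sum : ∀ {n} (f : Fin n → ℕ) → sumF f ≡ sum f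
sumF-as-sum {zero} f = refl
sumF-as-sum {suc n} f = cong (f zero +_) (sumF-as-sum (f ∘ suc))

sumF-cong : ∀ {n} {f g : Fin n → ℕ} → f ≗ g → sumF f ≡ sumF g
sumF-cong {f = f} {g} f≗g = trans (sumF-as-sum f) (trans (sum-cong-≗ f≗g) (sym (sumF-as-sum g)))

sumF-mono : ∀ {n} {f g : Fin n → ℕ} → (∀ i → f i ≤ g i) → sumF f ≤ sumF g
sumF-mono {zero} f≤g = z≤n
sumF-mono {suc n} f≤g = +-mono-≤ (f≤g zero) (sumF-mono (f≤g ∘ suc))

sumF-ones : ∀ n → sumF {n} (λ _ → 1) ≡ n
sumF-ones zero = refl
sumF-ones (suc n) = cong suc (sumF-ones n)

sumF-comm : ∀ {m n} (F : Fin m → Fin n → ℕ) →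
  sumF (λ i → sumF (F i)) ≡ sumF (λ c → sumF (λ i → F i c))
sumF-comm F = begin
  sumF (λ i → sumF (F i))           ≡⟨ sumF-as-sum (λ i → sumF (F i)) ⟩
  sum (λ i → sumF (F i))            ≡⟨ sum-cong-≗ (λ i → sumF-as-sum (F i)) ⟩
  sum (λ i → sum (F i))             ≡⟨ ∑-comm F ⟩
  sum (λ c → sum (λ i → F i c))     ≡⟨ sum-cong-≗ (λ c → sumF-as-sum (λ i → F i c)) ⟨
  sum (λ c → sumF (λ i → F i c))    ≡⟨ sumF-as-sum (λ c → sumF (λ i → F i c)) ⟨
  sumF (λ c → sumF (λ i → F i c))   ∎
  where open ≡-Reasoning

sumF-remove : ∀ {n} (f : Fin (suc n) → ℕ) (i : Fin (suc n)) → sumF f ≡ f i + sumF (removeAt f i)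
sumF-remove f i = trans (sumF-as-sum f) (trans (sum-remove f) (cong (f i +_) (sym (sumF-as-sum (removeAt f i)))))

countF-cong : ∀ {n} {p q : Fin n → Bool} → p ≗ q → countF p ≡ countF q
countF-cong {p = p} {q} p≗q =
  trans (countF-as-sumF p) (trans (sumF-cong (cong ind ∘ p≗q)) (sym (countF-as-sumF q)))

countF-none : ∀ {n} (p : Fin n → Bool) → (∀ i → p i ≡ false) → countF p ≡ 0
countF-none {zero} p none = refl
countF-none {suc n} p none rewrite none zero = countF-none (p ∘ suc) (none ∘ suc)

countF-atMostOne : ∀ {n} (p : Fin n → Bool) →
  (∀ i j → i ≢ j → p i ≡ true → p j ≡ false) → countF p ≤ 1
countF-atMostOne {zero} p unique = z≤n
countF-atMostOne {suc n} p unique with p zero in p₀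
... | true rewrite countF-none (p ∘ suc) (λ i → unique zero (suc i) (λ ()) p₀) = s≤s z≤n
... | false = countF-atMostOne (p ∘ suc) (λ i j i≢j → unique (suc i) (suc j) (i≢j ∘ fsuc-injective))

countF-∨ : ∀ {n} (p q : Fin n → Bool) → (∀ i → p i ∧ q i ≡ false) →
  countF (λ i → p i ∨ q i) ≡ countF p + countF q
countF-∨ {zero} p q disjoint = refl
countF-∨ {suc n} p q disjoint with p zero | q zero | disjoint zero | countF-∨ (p ∘ suc) (q ∘ suc) (disjoint ∘ suc)
... | true  | false | _ | rest = cong suc rest
... | false | true  | _ | rest = trans (cong suc rest) (sym (+-suc _ _))
... | false | false | _ | rest = rest

countF-≟ : ∀ {n} (c : Fin n) → countF (λ p → ⌊ c ≟F p ⌋) ≡ 1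
countF-≟ {suc n} zero = cong suc (countF-none {n} (λ _ → false) (λ _ → refl))
countF-≟ (suc c) = trans (countF-cong (λ p → ⌊⌋-map′ _ _ (c ≟F p))) (countF-≟ c)

countF-nonzero-≤ : ∀ {n} (f : Fin n → ℕ) → countF (nonzero ∘ f) ≤ sumF f
countF-nonzero-≤ {zero} f = z≤n
countF-nonzero-≤ {suc n} f = +-mono-≤ (ind-nonzero-≤ (f zero)) (countF-nonzero-≤ (f ∘ suc))
  where
  ind-nonzero-≤ : ∀ a → ind (nonzero a) ≤ a
  ind-nonzero-≤ zero = z≤n
  ind-nonzero-≤ (suc a) = s≤s z≤n

countF-nonzero-of-sum≡0 : ∀ {n} (f : Fin n → ℕ) → sumF f ≡ 0 → countF (nonzero ∘ f) ≡ 0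
countF-nonzero-of-sum≡0 {zero} f _ = refl
countF-nonzero-of-sum≡0 {suc n} f sum≡0 with f zero
... | zero = countF-nonzero-of-sum≡0 (f ∘ suc) sum≡0

countF-nonzero-of-sum≡1 : ∀ {n} (f : Fin n → ℕ) → sumF f ≡ 1 → countF (nonzero ∘ f) ≡ 1
countF-nonzero-of-sum≡1 {suc n} f sum≡1 with f zero
... | zero     = countF-nonzero-of-sum≡1 (f ∘ suc) sum≡1
... | suc zero = cong suc (countF-nonzero-of-sum≡0 (f ∘ suc) (cong pred sum≡1))

allSubsets : ∀ n → (Vec Bool n → Bool) → Bool
allSubsets zero f = f []
allSubsets (suc n) f = allSubsets n (f ∘ (true ∷_)) ∧ allSubsets n (f ∘ (false ∷_))

allSubsets-sound : ∀ n (f : Vec Bool n → Bool) → T (allSubsets n f) → ∀ S → T (f S)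
allSubsets-sound zero f holds [] = holds
allSubsets-sound (suc n) f holds (true ∷ S) = allSubsets-sound n _ (proj₁ (Equivalence.to T-∧ holds)) S
allSubsets-sound (suc n) f holds (false ∷ S) = allSubsets-sound n _ (proj₂ (Equivalence.to T-∧ holds)) S

infixr 6 _∧-intro_
_∧-intro_ : ∀ {a b} → T a → T b → T (a ∧ b)
t ∧-intro u = Equivalence.from T-∧ (t , u)

modus-ponens : ∀ {a b} → T (not a ∨ b) → T a → T b
modus-ponens {true} b-holds _ = b-holds

-- The six perfect matchings of P.  Matching 5 consists of the five spokes;
-- each other one uses one spoke, two outer and two inner edges.
pm : Fin 6 → EdgeSet
pm zero                                = true  ∷ false ∷ true  ∷ false ∷ false ∷ false ∷ false ∷ false ∷ false ∷ true  ∷ true  ∷ false ∷ false ∷ true  ∷ false ∷ []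
pm (suc zero)                          = true  ∷ false ∷ false ∷ true  ∷ false ∷ false ∷ false ∷ true  ∷ false ∷ false ∷ false ∷ false ∷ true  ∷ false ∷ true  ∷ []
pm (suc (suc zero))                    = false ∷ true  ∷ false ∷ true  ∷ false ∷ true  ∷ false ∷ false ∷ false ∷ false ∷ false ∷ true  ∷ false ∷ true  ∷ false ∷ []
pm (suc (suc (suc zero)))              = false ∷ true  ∷ false ∷ false ∷ true  ∷ false ∷ false ∷ false ∷ true  ∷ false ∷ true  ∷ false ∷ true  ∷ false ∷ false ∷ []
pm (suc (suc (suc (suc zero))))        = false ∷ false ∷ true  ∷ false ∷ true  ∷ false ∷ true  ∷ false ∷ false ∷ false ∷ false ∷ true  ∷ false ∷ false ∷ true  ∷ []
pm (suc (suc (suc (suc (suc zero))))) = false ∷ false ∷ false ∷ false ∷ false ∷ true  ∷ true  ∷ true  ∷ true  ∷ true  ∷ false ∷ false ∷ false ∷ false ∷ false ∷ []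

exactlyOne : Bool → Bool → Bool → Bool
exactlyOne a b c = ind a + ind b + ind c ≡ᵇ 1

-- The degree of a vertex whose edges carry the Booleans a, b, c is this sum.
exactlyOne-sound : ∀ a b c → ind a + (ind b + (ind c + 0)) ≡ 1 → T (exactlyOne a b c)
exactlyOne-sound true  false false _ = tt
exactlyOne-sound false true  false _ = tt
exactlyOne-sound false false true  _ = tt
exactlyOne-sound true  true  _     ()
exactlyOne-sound true  false true  ()
exactlyOne-sound false true  true  ()
exactlyOne-sound false false false ()

-- P is cubic; S is a perfect matching iff it contains exactly one of the
-- three edges at each vertex.  This fast test lists the three edges at
-- vertices 0, …, 9 in turn.
coversOnce : EdgeSet → Bool
coversOnce (s0 ∷ s1 ∷ s2 ∷ s3 ∷ s4 ∷ s5 ∷ s6 ∷ s7 ∷ s8 ∷ s9 ∷ s10 ∷ s11 ∷ s12 ∷ s13 ∷ s14 ∷ []) =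
  exactlyOne s0 s4 s5 ∧ exactlyOne s0 s1 s6 ∧ exactlyOne s1 s2 s7 ∧ exactlyOne s2 s3 s8 ∧
  exactlyOne s3 s4 s9 ∧ exactlyOne s5 s10 s14 ∧ exactlyOne s6 s12 s13 ∧ exactlyOne s7 s10 s11 ∧
  exactlyOne s8 s13 s14 ∧ exactlyOne s9 s11 s12

coversOnce-sound : ∀ S → IsPerfectMatchingP S → T (coversOnce S)
coversOnce-sound (s0 ∷ s1 ∷ s2 ∷ s3 ∷ s4 ∷ s5 ∷ s6 ∷ s7 ∷ s8 ∷ s9 ∷ s10 ∷ s11 ∷ s12 ∷ s13 ∷ s14 ∷ []) deg≡1 =
  exactlyOne-sound s0 s4 s5 (deg≡1 (# 0)) ∧-intro exactlyOne-sound s0 s1 s6 (deg≡1 (# 1)) ∧-intro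
  exactlyOne-sound s1 s2 s7 (deg≡1 (# 2)) ∧-intro exactlyOne-sound s2 s3 s8 (deg≡1 (# 3)) ∧-intro
  exactlyOne-sound s3 s4 s9 (deg≡1 (# 4)) ∧-intro exactlyOne-sound s5 s10 s14 (deg≡1 (# 5)) ∧-intro
  exactlyOne-sound s6 s12 s13 (deg≡1 (# 6)) ∧-intro exactlyOne-sound s7 s10 s11 (deg≡1 (# 7)) ∧-intro
  exactlyOne-sound s8 s13 s14 (deg≡1 (# 8)) ∧-intro exactlyOne-sound s9 s11 s12 (deg≡1 (# 9))

listed? : (S : EdgeSet) → Dec (∃ λ p → pm p ≡ S)
listed? S = any? (λ p → ≡-dec _≟B_ (pm p) S)

listedIfCovered : EdgeSet → Bool
listedIfCovered S = not (coversOnce S) ∨ ⌊ listed? S ⌋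

-- Exhaustive check of all 2^15 edge sets.
listedIfCovered-all : T (allSubsets 15 listedIfCovered)
listedIfCovered-all = tt

classify : ∀ S → IsPerfectMatchingP S → ∃ λ p → pm p ≡ S
classify S S-pm = toWitness {a? = listed? S} (modus-ponens
  (allSubsets-sound 15 listedIfCovered listedIfCovered-all S) (coversOnce-sound S S-pm))

pm-distinct : ∀ p q → (pm p ≟S pm q) ≡ ⌊ p ≟F q ⌋
pm-distinct = toWitness {a? = all? λ p → all? λ q → (pm p ≟S pm q) ≟B ⌊ p ≟F q ⌋} _

SharedEdge : Fin 6 → Fin 6 → E → Set
SharedEdge p q e = ∀ c → e ∈E pm c ≡ ⌊ c ≟F p ⌋ ∨ ⌊ c ≟F q ⌋

sharedEdge : ∀ p q → p ≢ q → ∃ (SharedEdge p q)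
sharedEdge = toWitness {a? = all? λ p → all? λ q → ¬? (p ≟F q) →-dec
  any? λ e → all? λ c → (e ∈E pm c) ≟B (⌊ c ≟F p ⌋ ∨ ⌊ c ≟F q ⌋)} _

pm-unique : ∀ S → IsPerfectMatchingP S → countF (λ p → S ≟S pm p) ≡ 1
pm-unique S S-pm with classify S S-pm
... | c , refl = trans (countF-cong (pm-distinct c)) (countF-≟ c)

mult-total : ∀ {n} (C : Fin n → EdgeSet) → (∀ i → IsPerfectMatchingP (C i)) →
  sumF (λ p → mult C (pm p)) ≡ n
mult-total {n} C C-pm = begin
  sumF (λ p → countF (λ i → C i ≟S pm p))        ≡⟨ sumF-cong (λ p → countF-as-sumF (λ i → C i ≟S pm p)) ⟩
  sumF (λ p → sumF (λ i → ind (C i ≟S pm p)))    ≡⟨ sumF-comm (λ p i → ind (C i ≟S pm p)) ⟩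
  sumF (λ i → sumF (λ p → ind (C i ≟S pm p)))    ≡⟨ sumF-cong (λ i → sym (countF-as-sumF (λ p → C i ≟S pm p))) ⟩
  sumF (λ i → countF (λ p → C i ≟S pm p))        ≡⟨ sumF-cong (λ i → pm-unique (C i) (C-pm i)) ⟩
  sumF {n} (λ _ → 1)                             ≡⟨ sumF-ones n ⟩
  n                                              ∎
  where open ≡-Reasoning

≟-disjoint : ∀ {n} {p q : Fin n} → p ≢ q → ∀ c → ⌊ c ≟F p ⌋ ∧ ⌊ c ≟F q ⌋ ≡ false
≟-disjoint {p = p} {q} p≢q c with c ≟F p | c ≟F q
... | no _     | _        = refl
... | yes _    | no _     = refl
... | yes refl | yes refl = ⊥-elim (p≢q refl)

mult-shared : ∀ {n} (C : Fin n → EdgeSet) → (∀ i → IsPerfectMatchingP (C i)) →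
  ∀ {p q e} → p ≢ q → SharedEdge p q e → countF (λ i → e ∈E C i) ≡ mult C (pm p) + mult C (pm q)
mult-shared C C-pm {p} {q} {e} p≢q shared =
  trans (countF-cong (λ i → member (C i) (C-pm i)))
        (countF-∨ (λ i → C i ≟S pm p) (λ i → C i ≟S pm q) (λ i → disjoint (C i) (C-pm i)))
  where
  member : ∀ S → IsPerfectMatchingP S → e ∈E S ≡ (S ≟S pm p) ∨ (S ≟S pm q)
  member S S-pm with classify S S-pm
  ... | c , refl = trans (shared c) (sym (cong₂ _∨_ (pm-distinct c p) (pm-distinct c q)))
  disjoint : ∀ S → IsPerfectMatchingP S → (S ≟S pm p) ∧ (S ≟S pm q) ≡ false
  disjoint S S-pm with classify S S-pm
  ... | c , refl = trans (cong₂ _∧_ (pm-distinct c p) (pm-distinct c q)) (≟-disjoint p≢q c)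

∈-type : ∀ {k} (M : EdgeSetM k) e → e ∈E type M ≡ nonzero (countF (M e))
∈-type M e = lookup∘tabulate (nonzero ∘ countF ∘ M) e

-- The type of a perfect matching of P^M is a perfect matching of P: the
-- copies at v sum to 1, so exactly one edge at v has a copy in M.
type-isPM : ∀ {k} (N : Fin k → EdgeSet) (M : EdgeSetM k) →
  IsPerfectMatchingM N M → IsPerfectMatchingP (type M)
type-isPM N M (_ , deg≡1) v =
  trans (countF-cong covered) (countF-nonzero-of-sum≡1 copiesAt (deg≡1 v))
  where
  copiesAt : E → ℕ
  copiesAt e = if incident v e then countF (M e) else 0
  covered : ∀ e → (incident v e ∧ (e ∈E type M)) ≡ nonzero (copiesAt e)
  covered e rewrite ∈-type M e with incident v e
  ... | true  = refl
  ... | false = refl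

copyExists : ∀ {k} → (Fin k → EdgeSet) → E → Fin (suc k) → Bool
copyExists N e zero = true
copyExists N e (suc j) = e ∈E N j

copy-used-at-most-once : ∀ {k} (N : Fin k → EdgeSet) (M' : Fin (suc k) → EdgeSetM k) →
  (∀ i → IsPerfectMatchingM N (M' i)) → (∀ i i' → i ≢ i' → Disjoint (M' i) (M' i')) →
  ∀ e c → countF (λ i → M' i e c) ≤ ind (copyExists N e c)
copy-used-at-most-once N M' M'-pm disjoint e zero =
  countF-atMostOne (λ i → M' i e zero) (λ i i' i≢i' → disjoint i i' i≢i' e zero)
copy-used-at-most-once N M' M'-pm disjoint e (suc j) with e ∈E N j in exists
... | true  = countF-atMostOne (λ i → M' i e (suc j)) (λ i i' i≢i' → disjoint i i' i≢i' e (suc j))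
... | false = ≤-reflexive (countF-none (λ i → M' i e (suc j)) unused)
  where
  unused : ∀ i → M' i e (suc j) ≡ false
  unused i with M' i e (suc j) in used
  ... | false = refl
  ... | true with () ← trans (sym exists) (proj₁ (M'-pm i) e (suc j) used)

-- At most 1 + #{j | e ∈ N_j} of the types contain e, since each type
-- containing e uses its own copy of e.
edge-bound : ∀ {k} (N : Fin k → EdgeSet) (M' : Fin (suc k) → EdgeSetM k) →
  (∀ i → IsPerfectMatchingM N (M' i)) → (∀ i i' → i ≢ i' → Disjoint (M' i) (M' i')) →
  ∀ e → countF (λ i → e ∈E type (M' i)) ≤ suc (countF (λ j → e ∈E N j))
edge-bound N M' M'-pm disjoint e = begin
  countF (λ i → e ∈E type (M' i))              ≡⟨ countF-cong (λ i → ∈-type (M' i) e) ⟩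
  countF (λ i → nonzero (countF (M' i e)))     ≤⟨ countF-nonzero-≤ (λ i → countF (M' i e)) ⟩
  sumF (λ i → countF (M' i e))                 ≡⟨ sumF-cong (λ i → countF-as-sumF (M' i e)) ⟩
  sumF (λ i → sumF (λ c → ind (M' i e c)))     ≡⟨ sumF-comm (λ i c → ind (M' i e c)) ⟩
  sumF (λ c → sumF (λ i → ind (M' i e c)))     ≡⟨ sumF-cong (λ c → countF-as-sumF (λ i → M' i e c)) ⟨
  sumF (λ c → countF (λ i → M' i e c))         ≤⟨ sumF-mono (copy-used-at-most-once N M' M'-pm disjoint e) ⟩
  sumF (ind ∘ copyExists N e)                  ≡⟨ countF-as-sumF (copyExists N e) ⟨
  suc (countF (λ j → e ∈E N j))                ∎
  where open ≤-Reasoning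

PairwiseBounded : ∀ {n} → (x y : Fin n → ℕ) → Set
PairwiseBounded x y = ∀ p q → p ≢ q → y p + y q ≤ suc (x p + x q)

others-dominated : ∀ {n} (x y : Fin n → ℕ) → PairwiseBounded x y →
  ∀ {p} → x p < y p → ∀ q → p ≢ q → y q ≤ x q
others-dominated x y bounded {p} xₚ<yₚ q p≢q =
  +-cancelˡ-≤ (suc (x p)) (y q) (x q) (≤-trans (+-monoˡ-≤ (y q) xₚ<yₚ) (bounded p q p≢q))

-- With at least two entries, pairwise bounds give  Σ y ≤ 1 + Σ x : either
-- y₀ ≤ x₀ and we recurse, or y₀ > x₀ and then y₀ + y₁ ≤ 1 + x₀ + x₁ while
-- all remaining entries satisfy y ≤ x.
sum-bound : ∀ {n} (x y : Fin (suc (suc n)) → ℕ) → PairwiseBounded x y → sumF y ≤ suc (sumF x)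
sum-bound {zero} x y bounded
  rewrite +-identityʳ (y (# 1)) | +-identityʳ (x (# 1)) = bounded zero (suc zero) (λ ())
sum-bound {suc n} x y bounded with y zero ≤? x zero
... | yes y₀≤x₀ = begin
  y zero + sumF (y ∘ suc)         ≤⟨ +-mono-≤ y₀≤x₀ (sum-bound (x ∘ suc) (y ∘ suc) bounded-tail) ⟩
  x zero + suc (sumF (x ∘ suc))   ≡⟨ +-suc (x zero) (sumF (x ∘ suc)) ⟩
  suc (sumF x)                    ∎
  where
  open ≤-Reasoning
  bounded-tail : PairwiseBounded (x ∘ suc) (y ∘ suc)
  bounded-tail p q p≢q = bounded (suc p) (suc q) (p≢q ∘ fsuc-injective)
... | no y₀≰x₀ = begin
  y zero + (y (# 1) + sumF rest-y)     ≡⟨ +-assoc (y zero) (y (# 1)) (sumF rest-y) ⟨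
  (y zero + y (# 1)) + sumF rest-y     ≤⟨ +-mono-≤ (bounded zero (# 1) (λ ())) (sumF-mono rest-dominated) ⟩
  suc (x zero + x (# 1)) + sumF rest-x ≡⟨ cong suc (+-assoc (x zero) (x (# 1)) (sumF rest-x)) ⟩
  suc (x zero + (x (# 1) + sumF rest-x)) ∎
  where
  open ≤-Reasoning
  rest-y rest-x : Fin (suc n) → ℕ
  rest-y i = y (suc (suc i))
  rest-x i = x (suc (suc i))
  rest-dominated : ∀ i → rest-y i ≤ rest-x i
  rest-dominated i = others-dominated x y bounded (≰⇒> y₀≰x₀) (suc (suc i)) (λ ())

-- With at least three entries, pairwise bounds and  Σ y = 1 + Σ x  force
-- x ≤ y entrywise: the other entries of y sum to at most 1 more than
-- those of x, so entry m of y cannot fall below that of x.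
dominance : ∀ {n} (x y : Fin (suc (suc (suc n))) → ℕ) → PairwiseBounded x y →
  sumF y ≡ suc (sumF x) → ∀ m → x m ≤ y m
dominance x y bounded total m = +-cancelʳ-≤ (suc X′) (x m) (y m) (begin
  x m + suc X′          ≡⟨ +-suc (x m) X′ ⟩
  suc (x m + X′)        ≡⟨ cong suc (sumF-remove x m) ⟨
  suc (sumF x)          ≡⟨ total ⟨
  sumF y                ≡⟨ sumF-remove y m ⟩
  y m + Y′              ≤⟨ +-monoʳ-≤ (y m) (sum-bound (removeAt x m) (removeAt y m) bounded-others) ⟩
  y m + suc X′          ∎)
  where
  open ≤-Reasoning
  X′ Y′ : ℕ
  X′ = sumF (removeAt x m)
  Y′ = sumF (removeAt y m)
  bounded-others : PairwiseBounded (removeAt x m) (removeAt y m)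
  bounded-others p q p≢q = bounded (punchIn m p) (punchIn m q) (p≢q ∘ punchIn-injective m p q)

-- For distinct perfect matchings p, q of P, the types contain p and q at
-- most once more in total than N does: count the types containing the
-- edge shared by p and q.
types-pairwise-bounded : ∀ {k} (N : Fin k → EdgeSet) → (∀ j → IsPerfectMatchingP (N j)) →
  (M' : Fin (suc k) → EdgeSetM k) → (∀ i → IsPerfectMatchingM N (M' i)) →
  (∀ i i' → i ≢ i' → Disjoint (M' i) (M' i')) →
  PairwiseBounded (λ p → mult N (pm p)) (λ p → mult (λ i → type (M' i)) (pm p))
types-pairwise-bounded {k} N N-pm M' M'-pm disjoint p q p≢q = via (sharedEdge p q p≢q)
  where
  types : Fin (suc k) → EdgeSet
  types i = type (M' i)
  types-pm : ∀ i → IsPerfectMatchingP (types i)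
  types-pm i = type-isPM N (M' i) (M'-pm i)
  via : ∃ (SharedEdge p q) → mult types (pm p) + mult types (pm q) ≤ suc (mult N (pm p) + mult N (pm q))
  via (e , shared) = begin
    mult types (pm p) + mult types (pm q)  ≡⟨ mult-shared types types-pm p≢q shared ⟨
    countF (λ i → e ∈E types i)            ≤⟨ edge-bound N M' M'-pm disjoint e ⟩
    suc (countF (λ j → e ∈E N j))          ≡⟨ cong suc (mult-shared N N-pm p≢q shared) ⟩
    suc (mult N (pm p) + mult N (pm q))    ∎
    where open ≤-Reasoning

lemma2p3 : (k : ℕ) → 1 ≤ k → (N : Fin k → EdgeSet) → (∀ j → IsPerfectMatchingP (N j)) → (M' : Fin (suc k) → EdgeSetM k) → (∀ i → IsPerfectMatchingM N (M' i)) → (∀ i i' → i ≢ i' → Disjoint (M' i) (M' i')) → ∀ (m : EdgeSet) → IsPerfectMatchingP m → mult N m ≤ mult (λ i → type (M' i)) m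
lemma2p3 k _ N N-pm M' M'-pm disjoint m m-pm with classify m m-pm
... | p , refl = dominance x y (types-pairwise-bounded N N-pm M' M'-pm disjoint) total p
  where
  types : Fin (suc k) → EdgeSet
  types i = type (M' i)
  x y : Fin 6 → ℕ
  x q = mult N (pm q)
  y q = mult types (pm q)
  -- There are k + 1 types and k members of N, all perfect matchings of P.
  total : sumF y ≡ suc (sumF x)
  total = trans (mult-total types (λ i → type-isPM N (M' i) (M'-pm i))) (cong suc (sym (mult-total N N-pm)))
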